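{- Let $G$ be a connected graph with $c,w:V(G)\to\mathbb{N}$, let $D^*$ be a decision tree for $G$ with $c_G(D^*)=\texttt{OPT}(G)$, and for each integer $k\ge 0$ let $S_k^*$ be as defined in the context. Then $$2\cdot\texttt{OPT}(G)=2\cdot\sum_{k=0}^{w(G)-1}c(S_k^*)\ \ge\ \sum_{k=0}^{w(G)}c\left(S^*_{\lfloor k/2\rfloor}\right).$$
   Context: Graphs are simple and connected. For $v\in V(G)$, $G-v$ is the set of connected components of $G$ with $v$ deleted. A decision tree for $G$ is a rooted tree $D$ with $V(D)=V(G)$ defined recursively: its root $r$ is a vertex of $G$, and for each connected component $H$ of $G-r$ there is exactly one child of $r$, which is the root of a decision tree for $H$ (these subtrees being all of $D-r$). For $x\in V(G)$, $Q_G(D,x)$ is the root-to-$x$ path in $D$, and $c_G(D)=\sum_{x} w(x)\sum_{q\in Q_G(D,x)}c(q)$; $\texttt{OPT}(G)$ is the minimum of $c_G(D)$ over decision trees $D$. For $f\in\{c,w\}$ and $X\subseteq V(G)$, $f(X)=\sum_{v\in X}f(v)$, $f(G)=f(V(G))$. For $v\in V(G)$, $G_{D,v}$ is the subgraph of $G$ induced by the vertices of the subtree of $D$ rooted at $v$. Let $\mathcal{R}_{D^*}(G)=\{V(G_{D^*,v}) : v\in V(G)\}$. For an integer $k\ge 0$, $\mathcal{L}_k^*$ is the family of all maximal (under inclusion) sets $H\in\mathcal{R}_{D^*}(G)$ with $w(H)\le k$, and $S_k^*=V(G)\setminus\bigcup_{H\in\mathcal{L}_k^*}H$. -}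

module Defs where

open import Data.Nat using (ℕ; _+_; _*_; _≤?_)
open import Data.Bool using (Bool; true; false; not; _∧_; if_then_else_)
open import Data.Fin using (Fin)
open import Data.Fin.Subset using (Subset; _∈_; ⁅_⁆; _∪_; _-_; ⊥; Nonempty; _⊆_)
open import Data.Fin.Subset.Properties using (_∈?_; _⊂?_)
open import Data.List using (List; []; _∷_; map; allFin)
open import Data.Nat.ListAction using (sum)
open import Data.Bool.ListAction using (any; all)
open import Data.List.Relation.Unary.All using (All)
open import Data.List.Relation.Unary.Unique.Propositional using (Unique)
import Data.List.Membership.Propositional as LM
open import Data.Vec using (tabulate)
open import Data.Product using (_×_)
open import Relation.Nullary using (¬_; does)

record Graph (n : ℕ) : Set₁ where
  field
    Adj    : Fin n → Fin n → Set
    sym    : ∀ {u v} → Adj u v → Adj v u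
    irrefl : ∀ {u} → ¬ Adj u u
open Graph public

module _ {n : ℕ} (G : Graph n) where

  -- walks in G all of whose vertices lie in Y (i.e. walks in G[Y])
  data Walk (Y : Subset n) : Fin n → Fin n → Set where
    stay : ∀ {u} → u ∈ Y → Walk Y u u
    step : ∀ {u v x} → u ∈ Y → Adj G u v → Walk Y v x → Walk Y u x

  Connected : Set
  Connected = ∀ u v → Walk Data.Fin.Subset.⊤ u v

  IsComponent : Subset n → Subset n → Set
  IsComponent Y C =
    C ⊆ Y × Nonempty C
    × (∀ {u v} → u ∈ C → v ∈ C → Walk C u v)
    × (∀ {u v} → u ∈ C → v ∈ Y → Adj G u v → v ∈ C)

data Tree (n : ℕ) : Set where
  node : Fin n → List (Tree n) → Tree n

module _ {n : ℕ} where

  mutual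
    verts : Tree n → Subset n
    verts (node r ch) = ⁅ r ⁆ ∪ vertsL ch

    vertsL : List (Tree n) → Subset n
    vertsL [] = ⊥
    vertsL (t ∷ ts) = verts t ∪ vertsL ts

  mutual
    subtrees : Tree n → List (Tree n)
    subtrees (node r ch) = node r ch ∷ subtreesL ch

    subtreesL : List (Tree n) → List (Tree n)
    subtreesL [] = []
    subtreesL (t ∷ ts) = subtrees t Data.List.++ subtreesL ts

  -- Q(D,x): the root-to-x path in D (empty if x is not in D)
  mutual
    path : Tree n → Fin n → List (Fin n)
    path (node r ch) x =
      if does (x ∈? verts (node r ch)) then r ∷ pathL ch x else []

    pathL : List (Tree n) → Fin n → List (Fin n)
    pathL [] x = []
    pathL (t ∷ ts) x = path t x Data.List.++ pathL ts x

data IsDT {n : ℕ} (G : Graph n) : Subset n → Tree n → Set where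
  dt : ∀ {X r ch} → r ∈ X
     → All (λ t → IsComponent G (X - r) (verts t) × IsDT G (verts t) t) ch
     → Unique (map verts ch)
     → (∀ C → IsComponent G (X - r) C → C LM.∈ map verts ch)
     → IsDT G X (node r ch)

DecisionTree : ∀ {n} → Graph n → Tree n → Set
DecisionTree G D = IsDT G Data.Fin.Subset.⊤ D

module _ {n : ℕ} where

  sumFin : (Fin n → ℕ) → ℕ
  sumFin f = sum (map f (allFin n))

  weight : (Fin n → ℕ) → Subset n → ℕ
  weight f X = sumFin (λ x → if does (x ∈? X) then f x else 0)

  cost : (c w : Fin n → ℕ) → Tree n → ℕ
  cost c w D = sumFin (λ x → w x * sum (map c (path D x)))

  Rsets : Tree n → List (Subset n)
  Rsets D = map verts (subtrees D)

  inLk : (w : Fin n → ℕ) → Tree n → ℕ → Subset n → Bool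
  inLk w D k H =
    does (weight w H ≤? k)
    ∧ all (λ H' → not (does (weight w H' ≤? k) ∧ does (H ⊂? H'))) (Rsets D)

  S* : (w : Fin n → ℕ) → Tree n → ℕ → Subset n
  S* w D k = tabulate (λ x →
    not (any (λ H → inLk w D k H ∧ does (x ∈? H)) (Rsets D)))

-- Summing the cost of D along root-to-vertex paths gives cost(D) = Σₛ c(root s)·w(V(s)) over the
-- subtrees s of D, and the roots of the subtrees enumerate V(G) exactly once. The vertex sets of
-- the subtrees form a laminar family, which decides whether root s lies in S*_k: if w(V(s)) ≤ k,
-- a largest set of R of weight ≤ k containing root s is in L*_k; otherwise every set of R
-- containing root s contains V(s) and is too heavy. Hence c(S*_k) = Σₛ [k < w(V(s))]·c(root s),
-- and summing over k < w(G) recovers the cost. The inequality then follows from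
-- Σ_{k≤N} f(⌊k/2⌋) ≤ 2·Σ_{k≤N} f(k) and c(S*_{w(G)}) = 0.

module Submission where

open import Data.Bool using (Bool; true; false; T; not; _∧_; if_then_else_)
open import Data.Bool.Properties using (T-≡; T-∧)
open import Data.Fin using (Fin; zero; suc; _≟_)
open import Data.Fin.Properties using (sequence)
open import Data.Fin.Subset using (Subset; _∈_; _∉_; _⊆_; _⊂_; ∣_∣; ⊤; ⊥; ⁅_⁆; _∪_; _─_; _-_)
open import Data.Fin.Subset.Properties
  using (_∈?_; _⊂?_; ∈⊤; ∉⊥; ⊆⊤; ⊆-antisym; x∈⁅x⁆; x∈⁅y⁆⇒x≡y; x∈p∪q⁺; x∈p∪q⁻; p─q⊆p;
         x∈p∧x≢y⇒x∈p-y; p⊂q⇒p⊆q; p⊂q⇒∣p∣<∣q∣)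
open import Data.List using (List; []; _∷_; _++_; _∷ʳ_; map; filter; upTo; allFin)
open import Data.List.Extrema.Nat using (argmax; argmax-all; f[xs]≤f[argmax])
open import Data.List.Membership.Propositional using (find; lose) renaming (_∈_ to _∈ₗ_)
open import Data.List.Membership.Propositional.Properties
  using (∈-++⁻; ∈-map⁺; ∈-map⁻; ∈-filter⁺; ∈-filter⁻)
open import Data.List.Properties using (map-++; map-applyUpTo; applyUpTo-∷ʳ; map-tabulate)
open import Data.List.Relation.Unary.All as All using (All; []; _∷_)
import Data.List.Relation.Unary.All.Properties as All
open import Data.List.Relation.Unary.All.Properties using (all⁻)
open import Data.List.Relation.Unary.AllPairs using (AllPairs; []; _∷_)
open import Data.List.Relation.Unary.Any using (here; there)
open import Data.List.Relation.Unary.Any.Properties using (any⁺; any⁻)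
open import Data.List.Relation.Unary.Unique.Propositional using (Unique)
open import Data.Nat using (ℕ; zero; suc; _+_; _*_; _≤_; _<_; _<?_; ⌊_/2⌋; z≤n; s≤s)
open import Data.Nat.ListAction using (sum)
open import Data.Nat.ListAction.Properties using (sum-++)
open import Data.Nat.Properties hiding (_≟_)
open import Algebra.Properties.CommutativeSemigroup +-commutativeSemigroup using ()
  renaming (interchange to +-interchange)
open import Data.Nat.Tactic.RingSolver using (solve-∀)
open import Data.Product using (_×_; _,_; ∃; proj₁; proj₂)
open import Data.Sum using (inj₁; inj₂; [_,_])
open import Data.Vec using (_∷_)
open import Data.Vec.Base as V using ()
open import Data.Vec.Properties using (lookup∘tabulate; lookup⇒[]=; []=⇒lookup)
open import Defs hiding (sym)
open import Effect.Monad using (RawMonad)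
open import Function using (_∘_)
open import Function.Bundles using (Equivalence)
open import Relation.Binary.PropositionalEquality hiding ([_])
open import Relation.Nullary using (¬_; Dec; does; yes; no; contradiction; ¬?; _×-dec_)
open import Relation.Nullary.Decidable
  using (dec-true; dec-false; decidable-stable; ¬¬-excluded-middle)
open import Relation.Nullary.Negation using (¬¬-Monad)

-- Finite sums

Σ : ∀ {a} {A : Set a} → List A → (A → ℕ) → ℕ
Σ xs f = sum (map f xs)

module _ {a} {A : Set a} where

  Σ-cong : ∀ (xs : List A) {f g : A → ℕ} → (∀ {x} → x ∈ₗ xs → f x ≡ g x) → Σ xs f ≡ Σ xs g
  Σ-cong []       f≗g = refl
  Σ-cong (x ∷ xs) f≗g = cong₂ _+_ (f≗g (here refl)) (Σ-cong xs (f≗g ∘ there))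

  Σ-mono-≤ : ∀ (xs : List A) {f g : A → ℕ} → (∀ x → f x ≤ g x) → Σ xs f ≤ Σ xs g
  Σ-mono-≤ []       f≤g = z≤n
  Σ-mono-≤ (x ∷ xs) f≤g = +-mono-≤ (f≤g x) (Σ-mono-≤ xs f≤g)

  Σ-zero : ∀ (xs : List A) {f : A → ℕ} → (∀ {x} → x ∈ₗ xs → f x ≡ 0) → Σ xs f ≡ 0
  Σ-zero []       f≗0 = refl
  Σ-zero (x ∷ xs) f≗0 = cong₂ _+_ (f≗0 (here refl)) (Σ-zero xs (f≗0 ∘ there))

  Σ-distrib-+ : ∀ (xs : List A) (f g : A → ℕ) → Σ xs (λ x → f x + g x) ≡ Σ xs f + Σ xs g
  Σ-distrib-+ []       f g = refl
  Σ-distrib-+ (x ∷ xs) f g =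
    trans (cong (f x + g x +_) (Σ-distrib-+ xs f g)) (+-interchange (f x) (g x) (Σ xs f) (Σ xs g))

  *-distribˡ-Σ : ∀ m (xs : List A) (f : A → ℕ) → m * Σ xs f ≡ Σ xs (λ x → m * f x)
  *-distribˡ-Σ m []       f = *-zeroʳ m
  *-distribˡ-Σ m (x ∷ xs) f = trans (*-distribˡ-+ m (f x) (Σ xs f)) (cong (m * f x +_) (*-distribˡ-Σ m xs f))

  Σ-++ : ∀ (xs ys : List A) f → Σ (xs ++ ys) f ≡ Σ xs f + Σ ys f
  Σ-++ xs ys f = trans (cong sum (map-++ f xs ys)) (sum-++ (map f xs) (map f ys))

Σ-comm : ∀ {a b} {A : Set a} {B : Set b} (xs : List A) (ys : List B) (f : A → B → ℕ) →
         Σ xs (λ x → Σ ys (f x)) ≡ Σ ys (λ y → Σ xs (λ x → f x y))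
Σ-comm []       ys f = sym (Σ-zero ys (λ _ → refl))
Σ-comm (x ∷ xs) ys f = trans (cong (Σ ys (f x) +_) (Σ-comm xs ys f)) (sym (Σ-distrib-+ ys (f x) _))

Σ-allFin-suc : ∀ {n} (f : Fin (suc n) → ℕ) → Σ (allFin (suc n)) f ≡ f zero + Σ (allFin n) (f ∘ suc)
Σ-allFin-suc {n} f =
  cong (f zero +_) (trans (cong sum (map-tabulate suc f)) (sym (cong sum (map-tabulate (λ x → x) (f ∘ suc)))))

Σ-upTo-suc : ∀ N (f : ℕ → ℕ) → Σ (upTo (suc N)) f ≡ f 0 + Σ (upTo N) (f ∘ suc)
Σ-upTo-suc N f = cong (f 0 +_) (trans (cong sum (map-applyUpTo suc f N))
                                      (sym (cong sum (map-applyUpTo (λ k → k) (f ∘ suc) N))))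

Σ-upTo-∷ʳ : ∀ N (f : ℕ → ℕ) → Σ (upTo (suc N)) f ≡ Σ (upTo N) f + f N
Σ-upTo-∷ʳ N f = begin
  Σ (upTo (suc N)) f         ≡⟨ cong (λ ks → Σ ks f) (applyUpTo-∷ʳ (λ k → k) N) ⟨
  Σ (upTo N ∷ʳ N) f          ≡⟨ Σ-++ (upTo N) (N ∷ []) f ⟩
  Σ (upTo N) f + (f N + 0)   ≡⟨ cong (Σ (upTo N) f +_) (+-identityʳ (f N)) ⟩
  Σ (upTo N) f + f N         ∎
  where open ≡-Reasoning

[_<_] : ℕ → ℕ → ℕ → ℕ
[ k < h ] a = if does (k <? h) then a else 0

[<]-yes : ∀ {k h} a → k < h → [ k < h ] a ≡ a
[<]-yes {k} {h} a k<h rewrite dec-true (k <? h) k<h = refl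

[<]-no : ∀ {k h} a → ¬ k < h → [ k < h ] a ≡ 0
[<]-no {k} {h} a k≮h rewrite dec-false (k <? h) k≮h = refl

Σ-upTo-[<] : ∀ {N h} a → h ≤ N → Σ (upTo N) (λ k → [ k < h ] a) ≡ a * h
Σ-upTo-[<] {zero}  {zero}  a z≤n       = sym (*-zeroʳ a)
Σ-upTo-[<] {suc N} {zero}  a z≤n       =
  trans (Σ-upTo-suc N (λ k → [ k < 0 ] a)) (trans (Σ-zero (upTo N) (λ _ → refl)) (sym (*-zeroʳ a)))
Σ-upTo-[<] {suc N} {suc h} a (s≤s h≤N) =
  trans (Σ-upTo-suc N (λ k → [ k < suc h ] a)) (trans (cong (a +_) (Σ-upTo-[<] a h≤N)) (sym (*-suc a h)))

Σ-upTo-⌊/2⌋ : ∀ N (f : ℕ → ℕ) → Σ (upTo N) (f ∘ ⌊_/2⌋) ≤ 2 * Σ (upTo N) f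
Σ-upTo-⌊/2⌋ zero          f = z≤n
Σ-upTo-⌊/2⌋ (suc zero)    f = m≤m+n (f 0 + 0) (f 0 + 0 + 0)
Σ-upTo-⌊/2⌋ (suc (suc N)) f = begin
  Σ (upTo (suc (suc N))) (f ∘ ⌊_/2⌋)
    ≡⟨ trans (Σ-upTo-suc (suc N) (f ∘ ⌊_/2⌋)) (cong (f 0 +_) (Σ-upTo-suc N (f ∘ ⌊_/2⌋ ∘ suc))) ⟩
  f 0 + (f 0 + Σ (upTo N) (f ∘ suc ∘ ⌊_/2⌋))
    ≤⟨ +-monoʳ-≤ (f 0) (+-monoʳ-≤ (f 0) (Σ-upTo-⌊/2⌋ N (f ∘ suc))) ⟩
  f 0 + (f 0 + 2 * Σ (upTo N) (f ∘ suc))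
    ≤⟨ +-monoʳ-≤ (f 0) (+-monoʳ-≤ (f 0) (*-monoʳ-≤ 2 tail≤)) ⟩
  f 0 + (f 0 + 2 * Σ (upTo (suc N)) (f ∘ suc))
    ≡⟨ double-+ (f 0) (Σ (upTo (suc N)) (f ∘ suc)) ⟩
  2 * (f 0 + Σ (upTo (suc N)) (f ∘ suc))
    ≡⟨ cong (2 *_) (Σ-upTo-suc (suc N) f) ⟨
  2 * Σ (upTo (suc (suc N))) f ∎
  where
  open ≤-Reasoning
  double-+ : ∀ a b → a + (a + 2 * b) ≡ 2 * (a + b)
  double-+ = solve-∀
  tail≤ : Σ (upTo N) (f ∘ suc) ≤ Σ (upTo (suc N)) (f ∘ suc)
  tail≤ = ≤-trans (m≤m+n _ (f (suc N))) (≤-reflexive (sym (Σ-upTo-∷ʳ N (f ∘ suc))))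

-- Weights of vertex sets

restrict : ∀ {n} → Subset n → (Fin n → ℕ) → Fin n → ℕ
restrict X f x = if does (x ∈? X) then f x else 0

Disjoint : ∀ {n} → Subset n → Subset n → Set
Disjoint X Y = ∀ {x} → x ∈ X → x ∉ Y

module _ {n} {X : Subset n} (f : Fin n → ℕ) {x : Fin n} where

  restrict-∈ : x ∈ X → restrict X f x ≡ f x
  restrict-∈ x∈X rewrite dec-true (x ∈? X) x∈X = refl

  restrict-∉ : x ∉ X → restrict X f x ≡ 0
  restrict-∉ x∉X rewrite dec-false (x ∈? X) x∉X = refl

module _ {n} {X Y : Subset n} (f : Fin n → ℕ) where

  weight-mono-⊆ : X ⊆ Y → weight f X ≤ weight f Y
  weight-mono-⊆ X⊆Y = Σ-mono-≤ (allFin n) {restrict X f} {restrict Y f} restrict-≤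
    where
    restrict-≤ : ∀ x → restrict X f x ≤ restrict Y f x
    restrict-≤ x with x ∈? X
    ... | yes x∈X = ≤-reflexive (sym (restrict-∈ f (X⊆Y x∈X)))
    ... | no  _   = z≤n

  weight-∪ : Disjoint X Y → weight f (X ∪ Y) ≡ weight f X + weight f Y
  weight-∪ X#Y = trans (Σ-cong (allFin n) (λ {x} _ → restrict-∪ x)) (Σ-distrib-+ (allFin n) _ _)
    where
    restrict-∪ : ∀ x → restrict (X ∪ Y) f x ≡ restrict X f x + restrict Y f x
    restrict-∪ x with x ∈? X | x ∈? Y
    ... | yes x∈X | yes x∈Y = contradiction x∈Y (X#Y x∈X)
    ... | yes x∈X | no  _   = trans (restrict-∈ f (x∈p∪q⁺ (inj₁ x∈X))) (sym (+-identityʳ (f x)))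
    ... | no  _   | yes x∈Y = restrict-∈ f (x∈p∪q⁺ (inj₂ x∈Y))
    ... | no  x∉X | no  x∉Y = restrict-∉ f ([ x∉X , x∉Y ] ∘ x∈p∪q⁻ X Y)

module _ {n} (f : Fin n → ℕ) where

  weight-⊤ : weight f ⊤ ≡ sumFin f
  weight-⊤ = Σ-cong (allFin n) (λ _ → restrict-∈ f ∈⊤)

  weight-⊥ : weight f ⊥ ≡ 0
  weight-⊥ = Σ-zero (allFin n) (λ _ → restrict-∉ f ∉⊥)

weight-⁅⁆ : ∀ {n} (f : Fin n → ℕ) r → weight f ⁅ r ⁆ ≡ f r
weight-⁅⁆ {suc n} f zero    = trans (Σ-allFin-suc (restrict ⁅ zero ⁆ f))
  (trans (cong (f zero +_) (weight-⊥ (f ∘ suc))) (+-identityʳ (f zero)))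
weight-⁅⁆ {suc n} f (suc r) = trans (Σ-allFin-suc (restrict ⁅ suc r ⁆ f)) (weight-⁅⁆ (f ∘ suc) r)

x∈p─q⇒x∉q : ∀ {n} {x : Fin n} (p q : Subset n) → x ∈ p ─ q → x ∉ q
x∈p─q⇒x∉q {x = zero}  (true  ∷ p) (true ∷ q) () V.here
x∈p─q⇒x∉q {x = zero}  (false ∷ p) (true ∷ q) () V.here
x∈p─q⇒x∉q {x = suc x} (_ ∷ p)     (_ ∷ q)    (V.there x∈p─q) (V.there x∈q) = x∈p─q⇒x∉q p q x∈p─q x∈q

weight-insert : ∀ {n} (f : Fin n → ℕ) {X : Subset n} {r} → r ∈ X → weight f X ≡ f r + weight f (X - r)
weight-insert f {X} {r} r∈X = begin
  weight f X                       ≡⟨ cong (weight f) (⊆-antisym X⊆r∪X-r r∪X-r⊆X) ⟩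
  weight f (⁅ r ⁆ ∪ (X - r))       ≡⟨ weight-∪ f r#X-r ⟩
  weight f ⁅ r ⁆ + weight f (X - r) ≡⟨ cong (_+ weight f (X - r)) (weight-⁅⁆ f r) ⟩
  f r + weight f (X - r)           ∎
  where
  open ≡-Reasoning
  r#X-r : Disjoint ⁅ r ⁆ (X - r)
  r#X-r {x} x∈⁅r⁆ x∈X-r = x∈p─q⇒x∉q X ⁅ r ⁆ x∈X-r x∈⁅r⁆
  X⊆r∪X-r : X ⊆ ⁅ r ⁆ ∪ (X - r)
  X⊆r∪X-r {x} x∈X with x ≟ r
  ... | yes refl = x∈p∪q⁺ (inj₁ (x∈⁅x⁆ x))
  ... | no  x≢r  = x∈p∪q⁺ (inj₂ (x∈p∧x≢y⇒x∈p-y x∈X x≢r))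
  r∪X-r⊆X : ⁅ r ⁆ ∪ (X - r) ⊆ X
  r∪X-r⊆X {x} x∈r∪X-r with x∈p∪q⁻ ⁅ r ⁆ (X - r) x∈r∪X-r
  ... | inj₁ x∈⁅r⁆ = subst (_∈ X) (sym (x∈⁅y⁆⇒x≡y r x∈⁅r⁆)) r∈X
  ... | inj₂ x∈X-r = p─q⊆p X ⁅ r ⁆ x∈X-r

T-does⁺ : ∀ {P : Set} (P? : Dec P) → P → T (does P?)
T-does⁺ P? p = Equivalence.from T-≡ (dec-true P? p)

T-does⁻ : ∀ {P : Set} (P? : Dec P) → T (does P?) → P
T-does⁻ (yes p) _  = p
T-does⁻ (no _)  ()

T-not⁺ : ∀ {b} → ¬ T b → T (not b)
T-not⁺ {false} _   = _
T-not⁺ {true}  ¬tt = ¬tt _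

T-not⁻ : ∀ {b} → T (not b) → ¬ T b
T-not⁻ {false} _ ()
T-not⁻ {true}  ()

∈-tabulate⁺ : ∀ {n} {f : Fin n → Bool} {x} → T (f x) → x ∈ V.tabulate f
∈-tabulate⁺ {f = f} {x} fx = lookup⇒[]= x (V.tabulate f) (trans (lookup∘tabulate f x) (Equivalence.to T-≡ fx))

∈-tabulate⁻ : ∀ {n} {f : Fin n → Bool} {x} → x ∈ V.tabulate f → T (f x)
∈-tabulate⁻ {f = f} {x} x∈ = Equivalence.from T-≡ (trans (sym (lookup∘tabulate f x)) ([]=⇒lookup x∈))

-- Walks and components

module _ {n} (G : Graph n) where

  walk-start : ∀ {Y u v} → Walk G Y u v → u ∈ Y
  walk-start (stay u∈Y)     = u∈Y
  walk-start (step u∈Y _ _) = u∈Y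

  walk-end : ∀ {Y u v} → Walk G Y u v → v ∈ Y
  walk-end (stay v∈Y)   = v∈Y
  walk-end (step _ _ p) = walk-end p

  walk-++ : ∀ {Y u v x} → Walk G Y u v → Walk G Y v x → Walk G Y u x
  walk-++ (stay _)       q = q
  walk-++ (step u∈Y a p) q = step u∈Y a (walk-++ p q)

  walk-∷ʳ : ∀ {Y u v x} → Walk G Y u v → Adj G v x → x ∈ Y → Walk G Y u x
  walk-∷ʳ p a x∈Y = walk-++ p (step (walk-end p) a (stay x∈Y))

  walk-reverse : ∀ {Y u v} → Walk G Y u v → Walk G Y v u
  walk-reverse (stay u∈Y)     = stay u∈Y
  walk-reverse (step u∈Y a p) = walk-∷ʳ (walk-reverse p) (Graph.sym G a) u∈Y

  walk-closed : ∀ {Y Z C u v} → Z ⊆ Y → (∀ {a b} → a ∈ C → b ∈ Y → Adj G a b → b ∈ C) →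
                Walk G Z u v → u ∈ C → v ∈ C
  walk-closed Z⊆Y closed (stay _)     u∈C = u∈C
  walk-closed Z⊆Y closed (step _ a p) u∈C = walk-closed Z⊆Y closed p (closed u∈C (Z⊆Y (walk-start p)) a)

  component-⊆ : ∀ {Y C₁ C₂ x} → IsComponent G Y C₁ → IsComponent G Y C₂ → x ∈ C₁ → x ∈ C₂ → C₁ ⊆ C₂
  component-⊆ (C₁⊆Y , _ , walks₁ , _) (_ , _ , _ , closed₂) x∈C₁ x∈C₂ v∈C₁ =
    walk-closed C₁⊆Y closed₂ (walks₁ x∈C₁ v∈C₁) x∈C₂

  component-unique : ∀ {Y C₁ C₂ x} → IsComponent G Y C₁ → IsComponent G Y C₂ → x ∈ C₁ → x ∈ C₂ → C₁ ≡ C₂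
  component-unique C₁ C₂ x∈C₁ x∈C₂ = ⊆-antisym (component-⊆ C₁ C₂ x∈C₁ x∈C₂) (component-⊆ C₂ C₁ x∈C₂ x∈C₁)

  -- Adjacency is not assumed decidable, so the component of x exists only up to double negation.
  ¬¬-component : ∀ {Y x} → x ∈ Y → ¬ ¬ (∃ λ C → IsComponent G Y C × x ∈ C)
  ¬¬-component {Y} {x} x∈Y ¬C = sequence (RawMonad.rawApplicative ¬¬-Monad) (λ _ → ¬¬-excluded-middle)
                                   (¬C ∘ reachable-component)
    where
    reachable-component : (∀ v → Dec (Walk G Y x v)) → ∃ λ C → IsComponent G Y C × x ∈ C
    reachable-component reach? = C , (C⊆Y , (x , x∈C) , walks , closed) , x∈C
      where
      C : Subset n
      C = V.tabulate (λ v → does (reach? v))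
      reach⇒∈ : ∀ {v} → Walk G Y x v → v ∈ C
      reach⇒∈ {v} p = ∈-tabulate⁺ (T-does⁺ (reach? v) p)
      ∈⇒reach : ∀ {v} → v ∈ C → Walk G Y x v
      ∈⇒reach {v} v∈C = T-does⁻ (reach? v) (∈-tabulate⁻ v∈C)
      x∈C : x ∈ C
      x∈C = reach⇒∈ (stay x∈Y)
      C⊆Y : C ⊆ Y
      C⊆Y = walk-end ∘ ∈⇒reach
      lift : ∀ {u v} → Walk G Y x u → Walk G Y u v → Walk G C u v
      lift xu (stay _)     = stay (reach⇒∈ xu)
      lift xu (step _ a p) = step (reach⇒∈ xu) a (lift (walk-∷ʳ xu a (walk-start p)) p)
      walks : ∀ {u v} → u ∈ C → v ∈ C → Walk G C u v
      walks u∈C v∈C = lift (∈⇒reach u∈C) (walk-++ (walk-reverse (∈⇒reach u∈C)) (∈⇒reach v∈C))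
      closed : ∀ {u v} → u ∈ C → v ∈ Y → Adj G u v → v ∈ C
      closed u∈C v∈Y a = reach⇒∈ (walk-∷ʳ (∈⇒reach u∈C) a v∈Y)

module _ {n} {A : Set} {V : A → Subset n} where

  AllPairs-Disjoint⇒≡ : ∀ {xs a b x} → AllPairs (λ a b → Disjoint (V a) (V b)) xs →
                        a ∈ₗ xs → b ∈ₗ xs → x ∈ V a → x ∈ V b → a ≡ b
  AllPairs-Disjoint⇒≡ _         (here refl) (here refl) _   _   = refl
  AllPairs-Disjoint⇒≡ (V# ∷ _)  (here refl) (there b∈)  x∈a x∈b = contradiction x∈b (All.lookup V# b∈ x∈a)
  AllPairs-Disjoint⇒≡ (V# ∷ _)  (there a∈)  (here refl) x∈a x∈b = contradiction x∈a (All.lookup V# a∈ x∈b)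
  AllPairs-Disjoint⇒≡ (_ ∷ V#s) (there a∈)  (there b∈)  x∈a x∈b = AllPairs-Disjoint⇒≡ V#s a∈ b∈ x∈a x∈b

  components-Disjoint : ∀ (G : Graph n) {Y xs} → All (IsComponent G Y ∘ V) xs → Unique (map V xs) →
                        AllPairs (λ a b → Disjoint (V a) (V b)) xs
  components-Disjoint G {xs = []}    []       []         = []
  components-Disjoint G {xs = _ ∷ _} (C ∷ Cs) (V≢ ∷ V≢s) =
    All.zipWith (λ (≢ , C′) {_} x∈a x∈b → ≢ (component-unique G C C′ x∈a x∈b)) (All.map⁻ V≢ , Cs)
    ∷ components-Disjoint G Cs V≢s

-- Trees and decision trees

module _ {n : ℕ} where

  root : Tree n → Fin n
  root (node r _) = r

  root∈verts : ∀ (t : Tree n) → root t ∈ verts t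
  root∈verts (node r ch) = x∈p∪q⁺ (inj₁ (x∈⁅x⁆ r))

  ∈-vertsL⁺ : ∀ {t : Tree n} {ts} → t ∈ₗ ts → verts t ⊆ vertsL ts
  ∈-vertsL⁺ (here refl) x∈t = x∈p∪q⁺ (inj₁ x∈t)
  ∈-vertsL⁺ (there t∈ts) x∈t = x∈p∪q⁺ (inj₂ (∈-vertsL⁺ t∈ts x∈t))

  ∈-vertsL⁻ : ∀ (ts : List (Tree n)) {x} → x ∈ vertsL ts → ∃ λ t → t ∈ₗ ts × x ∈ verts t
  ∈-vertsL⁻ []       x∈⊥ = contradiction x∈⊥ ∉⊥
  ∈-vertsL⁻ (t ∷ ts) x∈  with x∈p∪q⁻ (verts t) (vertsL ts) x∈
  ... | inj₁ x∈t  = t , here refl , x∈t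
  ... | inj₂ x∈ts = let t′ , t′∈ts , x∈t′ = ∈-vertsL⁻ ts x∈ts in t′ , there t′∈ts , x∈t′

  ∈-subtreesL⁻ : ∀ (ts : List (Tree n)) {s} → s ∈ₗ subtreesL ts → ∃ λ t → t ∈ₗ ts × s ∈ₗ subtrees t
  ∈-subtreesL⁻ (t ∷ ts) s∈ with ∈-++⁻ (subtrees t) s∈
  ... | inj₁ s∈t  = t , here refl , s∈t
  ... | inj₂ s∈ts = let t′ , t′∈ts , s∈t′ = ∈-subtreesL⁻ ts s∈ts in t′ , there t′∈ts , s∈t′

  mutual
    subtree-⊆ : ∀ (t : Tree n) {s} → s ∈ₗ subtrees t → verts s ⊆ verts t
    subtree-⊆ (node r ch) (here refl) = λ x∈ → x∈
    subtree-⊆ (node r ch) (there s∈)  = x∈p∪q⁺ ∘ inj₂ ∘ subtreesL-⊆ ch s∈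

    subtreesL-⊆ : ∀ (ts : List (Tree n)) {s} → s ∈ₗ subtreesL ts → verts s ⊆ vertsL ts
    subtreesL-⊆ (t ∷ ts) s∈ with ∈-++⁻ (subtrees t) s∈
    ... | inj₁ s∈t  = x∈p∪q⁺ ∘ inj₁ ∘ subtree-⊆ t s∈t
    ... | inj₂ s∈ts = x∈p∪q⁺ ∘ inj₂ ∘ subtreesL-⊆ ts s∈ts

  Σ-subtreesL : ∀ (ts : List (Tree n)) (f : Tree n → ℕ) → Σ (subtreesL ts) f ≡ Σ ts (λ t → Σ (subtrees t) f)
  Σ-subtreesL []       f = refl
  Σ-subtreesL (t ∷ ts) f =
    trans (Σ-++ (subtrees t) (subtreesL ts) f) (cong (Σ (subtrees t) f +_) (Σ-subtreesL ts f))

weight-vertsL : ∀ {n} (f : Fin n → ℕ) {ts : List (Tree n)} →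
                AllPairs (λ s t → Disjoint (verts s) (verts t)) ts →
                weight f (vertsL ts) ≡ Σ ts (weight f ∘ verts)
weight-vertsL f {[]}     []          = weight-⊥ f
weight-vertsL f {t ∷ ts} (t# ∷ ts#) =
  trans (weight-∪ f t#ts) (cong (weight f (verts t) +_) (weight-vertsL f ts#))
  where
  t#ts : Disjoint (verts t) (vertsL ts)
  t#ts x∈t x∈ts = let t′ , t′∈ts , x∈t′ = ∈-vertsL⁻ ts x∈ts in All.lookup t# t′∈ts x∈t x∈t′

module _ {n} (c : Fin n → ℕ) where

  mutual
    Σ-path : ∀ (t : Tree n) x →
             Σ (path t x) c ≡ Σ (subtrees t) (λ s → restrict (verts s) (λ _ → c (root s)) x)
    Σ-path (node r ch) x with x ∈? verts (node r ch)
    ... | yes _   = cong (c r +_) (Σ-pathL ch x)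
    ... | no  x∉t =
      sym (Σ-zero (subtreesL ch) (λ s∈ → restrict-∉ _ (x∉t ∘ x∈p∪q⁺ ∘ inj₂ ∘ subtreesL-⊆ ch s∈)))

    Σ-pathL : ∀ (ts : List (Tree n)) x →
              Σ (pathL ts x) c ≡ Σ (subtreesL ts) (λ s → restrict (verts s) (λ _ → c (root s)) x)
    Σ-pathL []       x = refl
    Σ-pathL (t ∷ ts) x = begin
      Σ (path t x ++ pathL ts x) c                          ≡⟨ Σ-++ (path t x) (pathL ts x) c ⟩
      Σ (path t x) c + Σ (pathL ts x) c             ≡⟨ cong₂ _+_ (Σ-path t x) (Σ-pathL ts x) ⟩
      Σ (subtrees t) summand + Σ (subtreesL ts) summand             ≡⟨ Σ-++ (subtrees t) (subtreesL ts) summand ⟨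
      Σ (subtrees t ++ subtreesL ts) summand                        ∎
      where
      open ≡-Reasoning
      summand : Tree n → ℕ
      summand s = restrict (verts s) (λ _ → c (root s)) x

  cost-subtrees : ∀ w D → cost c w D ≡ Σ (subtrees D) (λ s → c (root s) * weight w (verts s))
  cost-subtrees w D = begin
    Σ (allFin n) (λ x → w x * Σ (path D x) c)
      ≡⟨ Σ-cong (allFin n) (λ {x} _ → trans (cong (w x *_) (Σ-path D x)) (*-distribˡ-Σ (w x) (subtrees D) _)) ⟩
    Σ (allFin n) (λ x → Σ (subtrees D) (λ s → w x * restrict (verts s) (λ _ → c (root s)) x))
      ≡⟨ Σ-comm (allFin n) (subtrees D) _ ⟩
    Σ (subtrees D) (λ s → Σ (allFin n) (λ x → w x * restrict (verts s) (λ _ → c (root s)) x))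
      ≡⟨ Σ-cong (subtrees D) (λ {s} _ → trans (Σ-cong (allFin n) (λ {x} _ → swap-restrict (verts s) x))
                                              (sym (*-distribˡ-Σ (c (root s)) (allFin n) _))) ⟩
    Σ (subtrees D) (λ s → c (root s) * weight w (verts s)) ∎
    where
    open ≡-Reasoning
    swap-restrict : ∀ {a} X x → w x * restrict X (λ _ → a) x ≡ a * restrict X w x
    swap-restrict {a} X x with x ∈? X
    ... | yes _ = *-comm (w x) a
    ... | no  _ = trans (*-zeroʳ (w x)) (sym (*-zeroʳ a))

module _ {n} (G : Graph n) where

  module DecisionTreeNode {X r ch} (r∈X : r ∈ X)
    (children : All (λ t → IsComponent G (X - r) (verts t) × IsDT G (verts t) t) ch)
    (unique : Unique (map verts ch))
    (complete : ∀ C → IsComponent G (X - r) C → C ∈ₗ map verts ch) where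

    child-⊆ : ∀ {t} → t ∈ₗ ch → verts t ⊆ X - r
    child-⊆ t∈ch = proj₁ (proj₁ (All.lookup children t∈ch))

    r∉child : ∀ {t} → t ∈ₗ ch → r ∉ verts t
    r∉child t∈ch r∈t = x∈p─q⇒x∉q X ⁅ r ⁆ (child-⊆ t∈ch r∈t) (x∈⁅x⁆ r)

    children-Disjoint : AllPairs (λ s t → Disjoint (verts s) (verts t)) ch
    children-Disjoint = components-Disjoint G (All.map proj₁ children) unique

    X-r≡vertsL : X - r ≡ vertsL ch
    X-r≡vertsL = ⊆-antisym X-r⊆vertsL vertsL⊆X-r
      where
      X-r⊆vertsL : X - r ⊆ vertsL ch
      X-r⊆vertsL {x} x∈X-r = decidable-stable (x ∈? vertsL ch) λ x∉ch →
        ¬¬-component G x∈X-r λ (C , isC , x∈C) →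
          let t , t∈ch , C≡t = ∈-map⁻ verts (complete C isC) in
          x∉ch (∈-vertsL⁺ t∈ch (subst (x ∈_) C≡t x∈C))
      vertsL⊆X-r : vertsL ch ⊆ X - r
      vertsL⊆X-r x∈ch = let t , t∈ch , x∈t = ∈-vertsL⁻ ch x∈ch in child-⊆ t∈ch x∈t

  mutual
    weight-roots : ∀ {X t} → IsDT G X t → ∀ f → Σ (subtrees t) (f ∘ root) ≡ weight f X
    weight-roots {X} {node r ch} (dt r∈X children unique complete) f = begin
      f r + Σ (subtreesL ch) (f ∘ root)                ≡⟨ cong (f r +_) (Σ-subtreesL ch (f ∘ root)) ⟩
      f r + Σ ch (λ t → Σ (subtrees t) (f ∘ root))     ≡⟨ cong (f r +_) (weight-roots-children children f) ⟩
      f r + Σ ch (weight f ∘ verts)                    ≡⟨ cong (f r +_) (weight-vertsL f children-Disjoint) ⟨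
      f r + weight f (vertsL ch)                       ≡⟨ cong (λ Y → f r + weight f Y) X-r≡vertsL ⟨
      f r + weight f (X - r)                           ≡⟨ weight-insert f r∈X ⟨
      weight f X                                       ∎
      where
      open ≡-Reasoning
      open DecisionTreeNode r∈X children unique complete

    weight-roots-children : ∀ {Y ts} → All (λ t → IsComponent G Y (verts t) × IsDT G (verts t) t) ts →
                            ∀ f → Σ ts (λ t → Σ (subtrees t) (f ∘ root)) ≡ Σ ts (weight f ∘ verts)
    weight-roots-children []             f = refl
    weight-roots-children ((_ , t) ∷ ts) f = cong₂ _+_ (weight-roots t f) (weight-roots-children ts f)

  mutual
    laminar : ∀ {X t s s′} → IsDT G X t → s ∈ₗ subtrees t → s′ ∈ₗ subtrees t →
              root s ∈ verts s′ → verts s ⊆ verts s′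
    laminar {t = node _ _} _ (here refl) (here refl) _ = λ x∈ → x∈
    laminar {t = t@(node _ _)} _ (there s∈) (here refl) _ = subtree-⊆ t (there s∈)
    laminar {t = node r ch} (dt r∈X children unique complete) (here refl) (there s′∈) r∈s′ =
      let t , t∈ch , s′∈t = ∈-subtreesL⁻ ch s′∈ in
      contradiction (subtree-⊆ t s′∈t r∈s′) (r∉child t∈ch)
      where open DecisionTreeNode r∈X children unique complete
    laminar {t = node r ch} {s} (dt r∈X children unique complete) (there s∈) (there s′∈) r∈s′
      with ∈-subtreesL⁻ ch s∈ | ∈-subtreesL⁻ ch s′∈
    ... | t , t∈ch , s∈t | t′ , t′∈ch , s′∈t′
      with AllPairs-Disjoint⇒≡ children-Disjoint t∈ch t′∈ch
             (subtree-⊆ t s∈t (root∈verts s)) (subtree-⊆ t′ s′∈t′ r∈s′)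
      where open DecisionTreeNode r∈X children unique complete
    ... | refl = laminar-children children t∈ch s∈t s′∈t′ r∈s′

    laminar-children : ∀ {Y ts t s s′} → All (λ t → IsComponent G Y (verts t) × IsDT G (verts t) t) ts →
                       t ∈ₗ ts → s ∈ₗ subtrees t → s′ ∈ₗ subtrees t → root s ∈ verts s′ → verts s ⊆ verts s′
    laminar-children ((_ , t) ∷ _) (here refl) = laminar t
    laminar-children (_ ∷ ts)      (there t∈)  = laminar-children ts t∈

-- The sets S*_k

module _ {n} (w : Fin n → ℕ) (D : Tree n) (k : ℕ) where

  InLk : Subset n → Set
  InLk H = weight w H ≤ k × (∀ {H′} → H′ ∈ₗ Rsets D → weight w H′ ≤ k → ¬ H ⊂ H′)

  InLk⇒inLk : ∀ {H} → InLk H → T (inLk w D k H)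
  InLk⇒inLk {H} (H≤k , maximal) =
    Equivalence.from T-∧ (T-does⁺ (weight w H ≤? k) H≤k , all⁻ _ (All.tabulate not-above))
    where
    not-above : ∀ {H′} → H′ ∈ₗ Rsets D → T (not (does (weight w H′ ≤? k) ∧ does (H ⊂? H′)))
    not-above {H′} H′∈ =
      T-does⁺ (¬? ((weight w H′ ≤? k) ×-dec (H ⊂? H′))) (λ (H′≤k , H⊂H′) → maximal H′∈ H′≤k H⊂H′)

  ∉S* : ∀ {H x} → H ∈ₗ Rsets D → InLk H → x ∈ H → x ∉ S* w D k
  ∉S* {H} {x} H∈ H∈Lk x∈H x∈S* =
    T-not⁻ (∈-tabulate⁻ x∈S*)
           (any⁺ _ (lose H∈ (Equivalence.from T-∧ (InLk⇒inLk H∈Lk , T-does⁺ (x ∈? H) x∈H))))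

  ∈S* : ∀ {x} → (∀ {H} → H ∈ₗ Rsets D → x ∈ H → k < weight w H) → x ∈ S* w D k
  ∈S* {x} heavy = ∈-tabulate⁺ (T-not⁺ λ covered →
    let H , H∈ , H-covers = find (any⁻ _ (Rsets D) covered)
        H∈Lk , x∈H        = Equivalence.to T-∧ H-covers
    in <⇒≱ (heavy H∈ (T-does⁻ (x ∈? H) x∈H)) (T-does⁻ (weight w H ≤? k) (proj₁ (Equivalence.to T-∧ H∈Lk))))

module _ {n} {G : Graph n} {D : Tree n} (D-dt : DecisionTree G D) (w : Fin n → ℕ) where

  root∈S* : ∀ {s k} → s ∈ₗ subtrees D → k < weight w (verts s) → root s ∈ S* w D k
  root∈S* {s} {k} s∈D k<s = ∈S* w D k heavy
    where
    heavy : ∀ {H} → H ∈ₗ Rsets D → root s ∈ H → k < weight w H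
    heavy H∈ r∈H with ∈-map⁻ verts H∈
    ... | s′ , s′∈D , refl = <-≤-trans k<s (weight-mono-⊆ w (laminar G D-dt s∈D s′∈D r∈H))

  root∉S* : ∀ {s k} → s ∈ₗ subtrees D → weight w (verts s) ≤ k → root s ∉ S* w D k
  root∉S* {s} {k} s∈D s≤k = ∉S* w D k (∈-map⁺ verts m∈D) (m≤k , maximal) r∈m
    where
    Candidate : Tree n → Set
    Candidate t = weight w (verts t) ≤ k × root s ∈ verts t
    candidate? : ∀ t → Dec (Candidate t)
    candidate? t = (weight w (verts t) ≤? k) ×-dec (root s ∈? verts t)
    candidates : List (Tree n)
    candidates = filter candidate? (subtrees D)
    m : Tree n
    m = argmax (∣_∣ ∘ verts) s candidates
    m-spec : m ∈ₗ subtrees D × Candidate m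
    m-spec = argmax-all (∣_∣ ∘ verts) (s∈D , s≤k , root∈verts s) (All.tabulate (∈-filter⁻ candidate?))
    m∈D : m ∈ₗ subtrees D
    m∈D = proj₁ m-spec
    m≤k : weight w (verts m) ≤ k
    m≤k = proj₁ (proj₂ m-spec)
    r∈m : root s ∈ verts m
    r∈m = proj₂ (proj₂ m-spec)
    maximal : ∀ {H′} → H′ ∈ₗ Rsets D → weight w H′ ≤ k → ¬ verts m ⊂ H′
    maximal H′∈ H′≤k m⊂H′ with ∈-map⁻ verts H′∈
    ... | t , t∈D , refl = <⇒≱ (p⊂q⇒∣p∣<∣q∣ m⊂H′)
      (All.lookup (f[xs]≤f[argmax] s candidates) (∈-filter⁺ candidate? t∈D (H′≤k , p⊂q⇒p⊆q m⊂H′ r∈m)))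

  weight-S* : ∀ (c : Fin n → ℕ) k →
              weight c (S* w D k) ≡ Σ (subtrees D) (λ s → [ k < weight w (verts s) ] (c (root s)))
  weight-S* c k = begin
    weight c (S* w D k)                               ≡⟨ weight-⊤ (restrict (S* w D k) c) ⟨
    weight (restrict (S* w D k) c) ⊤                  ≡⟨ weight-roots G D-dt (restrict (S* w D k) c) ⟨
    Σ (subtrees D) (restrict (S* w D k) c ∘ root)     ≡⟨ Σ-cong (subtrees D) restrict-root ⟩
    Σ (subtrees D) (λ s → [ k < weight w (verts s) ] (c (root s))) ∎
    where
    open ≡-Reasoning
    restrict-root : ∀ {s} → s ∈ₗ subtrees D →
                    restrict (S* w D k) c (root s) ≡ [ k < weight w (verts s) ] (c (root s))
    restrict-root {s} s∈D with k <? weight w (verts s)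
    ... | yes k<s = trans (restrict-∈ c (root∈S* s∈D k<s)) (sym ([<]-yes (c (root s)) k<s))
    ... | no  k≮s = trans (restrict-∉ c (root∉S* s∈D (≮⇒≥ k≮s))) (sym ([<]-no (c (root s)) k≮s))

  cost≡Σ-weight-S* : ∀ c → cost c w D ≡ Σ (upTo (weight w ⊤)) (λ k → weight c (S* w D k))
  cost≡Σ-weight-S* c = begin
    cost c w D
      ≡⟨ cost-subtrees c w D ⟩
    Σ (subtrees D) (λ s → c (root s) * weight w (verts s))
      ≡⟨ Σ-cong (subtrees D) (λ {s} _ → Σ-upTo-[<] (c (root s)) (weight-mono-⊆ w ⊆⊤)) ⟨
    Σ (subtrees D) (λ s → Σ (upTo (weight w ⊤)) (λ k → [ k < weight w (verts s) ] (c (root s))))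
      ≡⟨ Σ-comm (subtrees D) (upTo (weight w ⊤)) _ ⟩
    Σ (upTo (weight w ⊤)) (λ k → Σ (subtrees D) (λ s → [ k < weight w (verts s) ] (c (root s))))
      ≡⟨ Σ-cong (upTo (weight w ⊤)) (λ {k} _ → weight-S* c k) ⟨
    Σ (upTo (weight w ⊤)) (λ k → weight c (S* w D k)) ∎
    where open ≡-Reasoning

  weight-S*-total : ∀ c → weight c (S* w D (weight w ⊤)) ≡ 0
  weight-S*-total c = trans (weight-S* c (weight w ⊤))
    (Σ-zero (subtrees D) λ {s} _ → [<]-no (c (root s)) (≤⇒≯ (weight-mono-⊆ w ⊆⊤)))

lemma3 : ∀ {n} (G : Graph n) → Connected G → (c w : Fin n → ℕ)
    → (D* : Tree n) → DecisionTree G D*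
    → (∀ D → DecisionTree G D → cost c w D* ≤ cost c w D)
    → (2 * cost c w D* ≡ 2 * sum (map (λ k → weight c (S* w D* k)) (upTo (weight w ⊤))))
      × (sum (map (λ k → weight c (S* w D* ⌊ k /2⌋)) (upTo (suc (weight w ⊤))))
         ≤ 2 * sum (map (λ k → weight c (S* w D* k)) (upTo (weight w ⊤))))
lemma3 G _ c w D* D*-dt _ = cong (2 *_) (cost≡Σ-weight-S* D*-dt w c) , halved-sum≤
  where
  W : ℕ
  W = weight w ⊤
  g : ℕ → ℕ
  g k = weight c (S* w D* k)
  open ≤-Reasoning
  halved-sum≤ : Σ (upTo (suc W)) (g ∘ ⌊_/2⌋) ≤ 2 * Σ (upTo W) g
  halved-sum≤ = begin
    Σ (upTo (suc W)) (g ∘ ⌊_/2⌋)  ≤⟨ Σ-upTo-⌊/2⌋ (suc W) g ⟩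
    2 * Σ (upTo (suc W)) g        ≡⟨ cong (2 *_) (Σ-upTo-∷ʳ W g) ⟩
    2 * (Σ (upTo W) g + g W)      ≡⟨ cong (λ z → 2 * (Σ (upTo W) g + z)) (weight-S*-total D*-dt w c) ⟩
    2 * (Σ (upTo W) g + 0)        ≡⟨ cong (2 *_) (+-identityʳ (Σ (upTo W) g)) ⟩
    2 * Σ (upTo W) g              ∎
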